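{- Let $\mathcal{F}$ be an ABA-free hypergraph on a finite totally ordered vertex set $V$ and let $w\in V$. Let $\mathcal{F}'$ be the subhypergraph of $\mathcal{F}$ induced by $V\setminus\{w\}$, i.e., the hypergraph on $V\setminus\{w\}$ with hyperedges $\{F\cap (V\setminus\{w\}) : F\in\mathcal{F}\}$. If $v$ is an unskippable vertex of $\mathcal{F}'$, then at least one of $v$ and $w$ is unskippable in $\mathcal{F}$.
   Context: A hypergraph $\mathcal{F}$ on a totally ordered finite vertex set $V$ is ABA-free if there are no two hyperedges $A,B\in\mathcal{F}$ and vertices $x<y<z$ with $x,z\in A\setminus B$ and $y\in B\setminus A$. A vertex $a$ is skippable in a hypergraph $\mathcal{F}$ on an ordered vertex set if there exists $A\in\mathcal{F}$ with $\min(A)<a<\max(A)$ and $a\notin A$; otherwise $a$ is unskippable. -}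

module Defs where

open import Data.Nat using (ℕ)
open import Data.Fin using (Fin; _<_)
open import Data.Fin.Subset using (Subset; _∈_; _∉_; outside)
open import Data.Vec using (_[_]≔_)
open import Data.List using (List; map)
open import Data.List.Membership.Propositional using () renaming (_∈_ to _∈ₗ_)
open import Data.Empty using (⊥)
open import Data.Product using (∃-syntax; _×_)
open import Relation.Nullary using (¬_)

-- Vertex set: Fin n with its natural total order (every finite totally
-- ordered set is order-isomorphic to some Fin n).
-- A hypergraph is a finite list of hyperedges, each a subset of Fin n.
Hypergraph : ℕ → Set
Hypergraph n = List (Subset n)

ABAFree : ∀ {n} → Hypergraph n → Set
ABAFree {n} F =
  ∀ (A B : Subset n) → A ∈ₗ F → B ∈ₗ F → (x y z : Fin n) →
  x < y → y < z →
  x ∈ A → x ∉ B → z ∈ A → z ∉ B → y ∈ B → y ∉ A → ⊥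

-- a is skippable: some A ∈ F with min(A) < a < max(A) and a ∉ A.
-- "min(A) < a < max(A)" is written out as: there are x, z ∈ A with x < a < z.
Skippable : ∀ {n} → Hypergraph n → Fin n → Set
Skippable {n} F a =
  ∃[ A ] (A ∈ₗ F × ∃[ x ] ∃[ z ] (x ∈ A × z ∈ A × x < a × a < z × a ∉ A))

Unskippable : ∀ {n} → Hypergraph n → Fin n → Set
Unskippable F a = ¬ Skippable F a

removeVertex : ∀ {n} → Fin n → Subset n → Subset n
removeVertex w A = A [ w ]≔ outside

-- Induced subhypergraph on V \ {w}; its vertex set is V \ {w} with the
-- induced order (vertex w simply lies in no hyperedge).
induced : ∀ {n} → Fin n → Hypergraph n → Hypergraph n
induced w F = map (removeVertex w) F

{-# OPTIONS --safe #-}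
module Submission where

-- Suppose A ∈ F skips v and B ∈ F skips w, with x' < w < z' the ends of B.
-- As v is unskippable once w is deleted, A must have w as an end, say
-- w < v < z with w, z ∈ A, and no hyperedge avoiding v has vertices other
-- than w on both sides of v. Hence x' ∉ A, and B ∖ A contains some y > w:
-- v itself if v ∈ B, and otherwise z', which then lies between w and v.
-- Now x' < w < y is a forbidden B A B pattern. The case v < w is the mirror.

open import Defs
open import Data.Fin using (Fin; _<_)
open import Data.Fin.Properties using (_≟_; _<?_; <-trans; <-cmp; <⇒≢; any?)
open import Data.Fin.Subset using (Subset; _∈_; _∉_)
open import Data.Fin.Subset.Properties using (_∈?_)
open import Data.Vec.Properties using ([]≔-minimal; []≔-idempotent; []≔-lookup)
open import Data.List.Membership.Propositional using (find; lose) renaming (_∈_ to _∈ₗ_)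
open import Data.List.Membership.Propositional.Properties using (∈-map⁺)
import Data.List.Relation.Unary.Any as Any
open import Data.Sum using (_⊎_; inj₁; inj₂)
open import Data.Product using (_,_; _×_; ∃-syntax)
open import Data.Empty using (⊥; ⊥-elim)
open import Function using (_∘_)
open import Relation.Nullary using (Dec; yes; no; ¬?)
open import Relation.Nullary.Decidable using (_×-dec_; map′)
open import Relation.Binary.Definitions using (tri<; tri≈; tri>)
open import Relation.Binary.PropositionalEquality using (_≢_; refl; sym; trans; subst)

SkippedBy : ∀ {n} → Subset n → Fin n → Set
SkippedBy A a = ∃[ x ] ∃[ z ] (x ∈ A × z ∈ A × x < a × a < z × a ∉ A)

skippedBy? : ∀ {n} (A : Subset n) (a : Fin n) → Dec (SkippedBy A a)
skippedBy? A a =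
  any? λ x → any? λ z →
    x ∈? A ×-dec z ∈? A ×-dec x <? a ×-dec a <? z ×-dec ¬? (a ∈? A)

skippable? : ∀ {n} (F : Hypergraph n) (a : Fin n) → Dec (Skippable F a)
skippable? F a =
  map′ find (λ (A , A∈F , s) → lose A∈F s) (Any.any? (λ A → skippedBy? A a) F)

∈-removeVertex⁺ : ∀ {n} {p w : Fin n} {A : Subset n} →
                  p ≢ w → p ∈ A → p ∈ removeVertex w A
∈-removeVertex⁺ {p = p} {w} {A} p≢w = []≔-minimal A p w p≢w

∈-removeVertex⁻ : ∀ {n} {p w : Fin n} {A : Subset n} →
                  p ≢ w → p ∈ removeVertex w A → p ∈ A
∈-removeVertex⁻ {p = p} {w} {A} p≢w p∈ =
  subst (_∈_ p) (trans ([]≔-idempotent A w) ([]≔-lookup A w))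
        ([]≔-minimal (removeVertex w A) p w p≢w p∈)

skippable-induced : ∀ {n} {F : Hypergraph n} {A : Subset n} {w v x z : Fin n} →
                    v ≢ w → A ∈ₗ F → x ∈ A → z ∈ A → x ≢ w → z ≢ w →
                    x < v → v < z → v ∉ A → Skippable (induced w F) v
skippable-induced v≢w A∈F x∈A z∈A x≢w z≢w x<v v<z v∉A =
  _ , ∈-map⁺ _ A∈F , _ , _ ,
  ∈-removeVertex⁺ x≢w x∈A , ∈-removeVertex⁺ z≢w z∈A , x<v , v<z ,
  v∉A ∘ ∈-removeVertex⁻ v≢w

>⇒≢ : ∀ {n} {a b : Fin n} → b < a → a ≢ b
>⇒≢ b<a = <⇒≢ b<a ∘ sym

module _ {n} {F : Hypergraph n} {w v : Fin n}
         (aba : ABAFree F) (v≢w : v ≢ w) (U : Unskippable (induced w F) v) where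

  ¬skips-v-avoiding-w : ∀ {C : Subset n} {p q : Fin n} → C ∈ₗ F → v ∉ C →
                        p ∈ C → q ∈ C → p ≢ w → q ≢ w → p < v → v < q → ⊥
  ¬skips-v-avoiding-w C∈F v∉C p∈C q∈C p≢w q≢w p<v v<q =
    U (skippable-induced v≢w C∈F p∈C q∈C p≢w q≢w p<v v<q v∉C)

  module _ {A B : Subset n} {x' z' : Fin n} (A∈F : A ∈ₗ F) (B∈F : B ∈ₗ F)
           (w∈A : w ∈ A) (v∉A : v ∉ A)
           (x'∈B : x' ∈ B) (z'∈B : z' ∈ B) (x'<w : x' < w) (w<z' : w < z') (w∉B : w ∉ B) where

    left-endpoint-contradiction : ∀ {z} → z ∈ A → w < v → v < z → ⊥
    left-endpoint-contradiction {z} z∈A w<v v<z =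
      let y , w<y , y∈B , y∉A = right-of-w-in-B∖A
      in aba B A B∈F A∈F x' w y x'<w w<y x'∈B x'∉A y∈B y∉A w∈A w∉B
      where
      below-v∉A : ∀ {p} → p ≢ w → p < v → p ∉ A
      below-v∉A p≢w p<v p∈A = ¬skips-v-avoiding-w A∈F v∉A p∈A z∈A p≢w (>⇒≢ (<-trans w<v v<z)) p<v v<z

      x'∉A : x' ∉ A
      x'∉A = below-v∉A (<⇒≢ x'<w) (<-trans x'<w w<v)

      right-of-w-in-B∖A : ∃[ y ] (w < y × y ∈ B × y ∉ A)
      right-of-w-in-B∖A with v ∈? B | <-cmp z' v
      ... | yes v∈B | _             = v , w<v , v∈B , v∉A
      ... | no _    | tri< z'<v _ _ = z' , w<z' , z'∈B , below-v∉A (>⇒≢ w<z') z'<v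
      ... | no v∉B  | tri≈ _ refl _ = ⊥-elim (v∉B z'∈B)
      ... | no v∉B  | tri> _ _ v<z' =
        ⊥-elim (¬skips-v-avoiding-w B∈F v∉B x'∈B z'∈B (<⇒≢ x'<w) (>⇒≢ w<z') (<-trans x'<w w<v) v<z')

    right-endpoint-contradiction : ∀ {x} → x ∈ A → x < v → v < w → ⊥
    right-endpoint-contradiction {x} x∈A x<v v<w =
      let y , y<w , y∈B , y∉A = left-of-w-in-B∖A
      in aba B A B∈F A∈F y w z' y<w w<z' y∈B y∉A z'∈B z'∉A w∈A w∉B
      where
      above-v∉A : ∀ {p} → p ≢ w → v < p → p ∉ A
      above-v∉A p≢w v<p p∈A = ¬skips-v-avoiding-w A∈F v∉A x∈A p∈A (<⇒≢ (<-trans x<v v<w)) p≢w x<v v<p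

      z'∉A : z' ∉ A
      z'∉A = above-v∉A (>⇒≢ w<z') (<-trans v<w w<z')

      left-of-w-in-B∖A : ∃[ y ] (y < w × y ∈ B × y ∉ A)
      left-of-w-in-B∖A with v ∈? B | <-cmp x' v
      ... | yes v∈B | _             = v , v<w , v∈B , v∉A
      ... | no _    | tri> _ _ v<x' = x' , x'<w , x'∈B , above-v∉A (<⇒≢ x'<w) v<x'
      ... | no v∉B  | tri≈ _ refl _ = ⊥-elim (v∉B x'∈B)
      ... | no v∉B  | tri< x'<v _ _ =
        ⊥-elim (¬skips-v-avoiding-w B∈F v∉B x'∈B z'∈B (<⇒≢ x'<w) (>⇒≢ w<z') x'<v (<-trans v<w w<z'))

mainTheorem13 : ∀ {n} (F : Hypergraph n) (w v : Fin n) →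
    ABAFree F → v ≢ w → Unskippable (induced w F) v →
    Unskippable F v ⊎ Unskippable F w
mainTheorem13 F w v aba v≢w U with skippable? F v
... | no v-unskippable = inj₁ v-unskippable
... | yes (A , A∈F , x , z , x∈A , z∈A , x<v , v<z , v∉A) = inj₂ w-unskippable
  where
  w-unskippable : Unskippable F w
  w-unskippable (B , B∈F , _ , _ , x'∈B , z'∈B , x'<w , w<z' , w∉B) with x ≟ w | z ≟ w
  ... | yes refl | _        = left-endpoint-contradiction aba v≢w U A∈F B∈F x∈A v∉A
                                x'∈B z'∈B x'<w w<z' w∉B z∈A x<v v<z
  ... | no _     | yes refl = right-endpoint-contradiction aba v≢w U A∈F B∈F z∈A v∉A
                                x'∈B z'∈B x'<w w<z' w∉B x∈A x<v v<z
  ... | no x≢w   | no z≢w   = ¬skips-v-avoiding-w aba v≢w U A∈F v∉A x∈A z∈A x≢w z≢w x<v v<z
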